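{- Let $k\ge 1$ and $t\ge 0$ be integers. Let $s_0$ be an AP with at least $t+1$ elements $s_0(0)\le s_0(1)\le\dots\le s_0(t)\le\dots$. Let $s_1,\dots,s_k$ be APs (which may contain further integers not in $s_0$) such that every element $s_0(0),\dots,s_0(t-1)$ belongs to at least one of $s_1,\dots,s_k$, but $s_0(t)$ belongs to none of them. Suppose that each of $s_1,\dots,s_k$ has an element larger than $s_0(t)$. Then $t<2^k$.
   Context: An arithmetic progression (AP) is a finite sequence of integers $a, a+d, \dots, a+xd$ with $a,d,x$ integers, $d\ge 0$, $x\ge 0$, listed in increasing order; for an AP $s$, $s(i)$ denotes its $i$-th term counted from $s(0)=a$, so $s(i)=a+id$. An AP is identified with the set of its elements, and an AP contains an integer if that integer is one of its terms. -}

module Defs where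

open import Data.Nat as ℕ using (ℕ)
open import Data.Integer using (ℤ; +_; _+_; _*_)
open import Data.Product using (Σ; _×_)
open import Relation.Binary.PropositionalEquality using (_≡_)

record AP : Set where
  constructor mkAP
  field
    start  : ℤ
    diff   : ℕ
    len    : ℕ   -- x  (the AP has terms s(0), ..., s(x))
open AP public

term : AP → ℕ → ℤ
term s i = start s + (+ i) * (+ diff s)

_∈AP_ : ℤ → AP → Set
n ∈AP s = Σ ℕ λ i → (i ℕ.≤ len s) × (term s i ≡ n)

{-# OPTIONS --safe #-}
module Submission where

-- Write X = s₀(t) and d for the difference of s₀. For an AP s with start b ≤ X and difference e,
-- the function f(x , u) = [e ∣ u] − [e ∣ u + x d − (X − b)] vanishes identically in u as soon as
-- X − x d = s₀(t − x) lies in s, whereas f(0 , 0) = 1 when X ∉ s and s has an element above X.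
-- Multiplying these factors over the k APs, with an independent variable u_j in each factor,
-- gives a sum of 2^k terms of the shape r (h + x l) with h ∈ ℤ^k. Such a sum which vanishes for
-- x = 1, …, n, where n is at least the number of terms, also vanishes at x = 0: a difference in x
-- along one of the l removes that term. If t ≥ 2^k, the covering of s₀(0), …, s₀(t − 1) makes the
-- product vanish for x = 1, …, t, contradicting its value 1 at the origin.

open import Defs
open import Data.Nat as ℕ using (ℕ; zero; suc; _≤_; _<_; _^_; _∸_; s≤s)
import Data.Nat.Properties as ℕP
import Data.Nat.Divisibility as ℕD
open import Data.Integer as ℤ using (ℤ; +_; 0ℤ; 1ℤ; _+_; _*_; _-_; -_)
import Data.Integer.Properties as ℤP
open import Data.Integer.Divisibility.Signed
  using (_∣_; _∣?_; divides; ∣⇒∣ᵤ; ∣m∣n⇒∣m+n; ∣m∣n⇒∣m-n; ∣m⇒∣-m; ∣n⇒∣m*n; ∣-refl)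
open import Data.Integer.Tactic.RingSolver using (solve-∀)
open import Data.Vec using (Vec; []; _∷_; zipWith; map; head; tail; replicate)
open import Data.Vec.Properties using (zipWith-assoc; zipWith-comm; zipWith-inverseˡ; zipWith-identityʳ)
open import Data.List as List using (List; []; _∷_; length)
open import Data.List.Properties using (length-map)
open import Data.Product using (Σ; _×_; _,_)
open import Data.Fin using (Fin; zero; suc)
open import Data.Bool using (if_then_else_)
open import Data.Empty using (⊥-elim)
open import Function using (_∘_)
open import Function.Bundles using (mk⇔)
open import Relation.Binary.PropositionalEquality
  using (_≡_; refl; sym; trans; cong; cong₂; subst; subst₂; module ≡-Reasoning)
open import Relation.Nullary using (¬_; yes; no; does)
open import Relation.Nullary.Decidable using (dec-true; dec-false; does-⇔)

open ≡-Reasoning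

infixl 6 _⊕_
infixr 7 _·_

_⊕_ : ∀ {k} → Vec ℤ k → Vec ℤ k → Vec ℤ k
_⊕_ = zipWith _+_

⊖_ : ∀ {k} → Vec ℤ k → Vec ℤ k
⊖_ = map (λ c → - c)

_·_ : ∀ {k} → ℕ → Vec ℤ k → Vec ℤ k
x · l = map (+ x *_) l

·-suc : ∀ {k} x (l : Vec ℤ k) → suc x · l ≡ l ⊕ x · l
·-suc x []      = refl
·-suc x (c ∷ l) = cong₂ _∷_ (ℤP.suc-* (+ x) c) (·-suc x l)

⊕-assoc : ∀ {k} (h a b : Vec ℤ k) → h ⊕ a ⊕ b ≡ h ⊕ (a ⊕ b)
⊕-assoc = zipWith-assoc ℤP.+-assoc

⊕-·-suc : ∀ {k} (h l : Vec ℤ k) x → h ⊕ suc x · l ≡ h ⊕ l ⊕ x · l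
⊕-·-suc h l x = trans (cong (h ⊕_) (·-suc x l)) (sym (⊕-assoc h l (x · l)))

⊕-right-comm : ∀ {k} (h a b : Vec ℤ k) → h ⊕ a ⊕ b ≡ h ⊕ b ⊕ a
⊕-right-comm h a b = begin
  h ⊕ a ⊕ b   ≡⟨ ⊕-assoc h a b ⟩
  h ⊕ (a ⊕ b) ≡⟨ cong (h ⊕_) (zipWith-comm ℤP.+-comm a b) ⟩
  h ⊕ (b ⊕ a) ≡⟨ sym (⊕-assoc h b a) ⟩
  h ⊕ b ⊕ a   ∎

⊖-⊕-cancel : ∀ {k} (h l : Vec ℤ k) → h ⊕ ⊖ l ⊕ l ≡ h
⊖-⊕-cancel h l = begin
  h ⊕ ⊖ l ⊕ l            ≡⟨ ⊕-assoc h (⊖ l) l ⟩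
  h ⊕ (⊖ l ⊕ l)          ≡⟨ cong (h ⊕_) (zipWith-inverseˡ ℤP.+-inverseˡ l) ⟩
  h ⊕ replicate _ 0ℤ     ≡⟨ zipWith-identityʳ ℤP.+-identityʳ h ⟩
  h                      ∎

ShiftTerm : ℕ → Set
ShiftTerm k = (Vec ℤ k → ℤ) × Vec ℤ k

⟦_⟧ : ∀ {k} → List (ShiftTerm k) → ℕ → Vec ℤ k → ℤ
⟦ []          ⟧ x h = 0ℤ
⟦ (r , l) ∷ T ⟧ x h = r (h ⊕ x · l) + ⟦ T ⟧ x h

Δ : ∀ {k} → Vec ℤ k → ShiftTerm k → ShiftTerm k
Δ l (r , l′) = (λ v → r (v ⊕ l′) - r (v ⊕ l)) , l′

⟦map-Δ⟧ : ∀ {k} (l : Vec ℤ k) T x h →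
  ⟦ List.map (Δ l) T ⟧ x h ≡ ⟦ T ⟧ (suc x) h - ⟦ T ⟧ x (h ⊕ l)
⟦map-Δ⟧ l []             x h = refl
⟦map-Δ⟧ l ((r , l′) ∷ T) x h = begin
  (r (h ⊕ x · l′ ⊕ l′) - r (h ⊕ x · l′ ⊕ l)) + ⟦ List.map (Δ l) T ⟧ x h
    ≡⟨ cong₂ (λ a b → (r a - r b) + ⟦ List.map (Δ l) T ⟧ x h) shift₁ (⊕-right-comm h (x · l′) l) ⟩
  (a - b) + ⟦ List.map (Δ l) T ⟧ x h
    ≡⟨ cong (λ z → (a - b) + z) (⟦map-Δ⟧ l T x h) ⟩
  (a - b) + (c - d)
    ≡⟨ interchange a b c d ⟩
  (a + c) - (b + d)
    ∎
  where
  a = r (h ⊕ suc x · l′)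
  b = r (h ⊕ l ⊕ x · l′)
  c = ⟦ T ⟧ (suc x) h
  d = ⟦ T ⟧ x (h ⊕ l)
  shift₁ : h ⊕ x · l′ ⊕ l′ ≡ h ⊕ suc x · l′
  shift₁ = trans (⊕-right-comm h (x · l′) l′) (sym (⊕-·-suc h l′ x))
  interchange : ∀ a b c d → (a - b) + (c - d) ≡ (a + c) - (b + d)
  interchange = solve-∀

-- Differencing along l cancels the term (r , l), since r (h + (x+1) l) = r ((h + l) + x l).
⟦map-Δ⟧-cancel : ∀ {k} (r : Vec ℤ k → ℤ) l T x h →
  ⟦ List.map (Δ l) T ⟧ x h ≡ ⟦ (r , l) ∷ T ⟧ (suc x) h - ⟦ (r , l) ∷ T ⟧ x (h ⊕ l)
⟦map-Δ⟧-cancel r l T x h = begin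
  ⟦ List.map (Δ l) T ⟧ x h
    ≡⟨ ⟦map-Δ⟧ l T x h ⟩
  ⟦ T ⟧ (suc x) h - ⟦ T ⟧ x (h ⊕ l)
    ≡⟨ sym (cancel (r (h ⊕ l ⊕ x · l)) (⟦ T ⟧ (suc x) h) (⟦ T ⟧ x (h ⊕ l))) ⟩
  (r (h ⊕ l ⊕ x · l) + ⟦ T ⟧ (suc x) h) - (r (h ⊕ l ⊕ x · l) + ⟦ T ⟧ x (h ⊕ l))
    ≡⟨ cong (λ v → (r v + ⟦ T ⟧ (suc x) h) - ⟦ (r , l) ∷ T ⟧ x (h ⊕ l)) (sym (⊕-·-suc h l x)) ⟩
  (r (h ⊕ suc x · l) + ⟦ T ⟧ (suc x) h) - (r (h ⊕ l ⊕ x · l) + ⟦ T ⟧ x (h ⊕ l))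
    ∎
  where
  cancel : ∀ a c d → (a + c) - (a + d) ≡ c - d
  cancel = solve-∀

vanishes-at-0 : ∀ {k} n (T : List (ShiftTerm k)) → length T ≤ n →
  (∀ x → 1 ≤ x → x ≤ n → ∀ h → ⟦ T ⟧ x h ≡ 0ℤ) → ∀ h → ⟦ T ⟧ 0 h ≡ 0ℤ
vanishes-at-0 n       []            _           _      h = refl
vanishes-at-0 (suc n) ((r , l) ∷ T) (s≤s |T|≤n) vanish h = begin
  ⟦ S ⟧ 0 h            ≡⟨ cong (⟦ S ⟧ 0) (sym (⊖-⊕-cancel h l)) ⟩
  ⟦ S ⟧ 0 (h′ ⊕ l)     ≡⟨ sym (ℤP.i-j≡0⇒i≡j _ _ S-difference-at-0) ⟩
  ⟦ S ⟧ 1 h′           ≡⟨ vanish 1 (s≤s ℕ.z≤n) (s≤s ℕ.z≤n) h′ ⟩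
  0ℤ                   ∎
  where
  S  = (r , l) ∷ T
  h′ = h ⊕ ⊖ l
  ΔT-vanishes : ∀ x → 1 ≤ x → x ≤ n → ∀ h → ⟦ List.map (Δ l) T ⟧ x h ≡ 0ℤ
  ΔT-vanishes x 1≤x x≤n h = begin
    ⟦ List.map (Δ l) T ⟧ x h     ≡⟨ ⟦map-Δ⟧-cancel r l T x h ⟩
    ⟦ S ⟧ (suc x) h - ⟦ S ⟧ x (h ⊕ l)
      ≡⟨ cong₂ _-_ (vanish (suc x) (s≤s ℕ.z≤n) (s≤s x≤n) h) (vanish x 1≤x (ℕP.m≤n⇒m≤1+n x≤n) (h ⊕ l)) ⟩
    0ℤ                           ∎
  ΔT-vanishes-at-0 : ∀ h → ⟦ List.map (Δ l) T ⟧ 0 h ≡ 0ℤ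
  ΔT-vanishes-at-0 = vanishes-at-0 n (List.map (Δ l) T)
    (subst (_≤ n) (sym (length-map (Δ l) T)) |T|≤n) ΔT-vanishes
  S-difference-at-0 : ⟦ S ⟧ 1 h′ - ⟦ S ⟧ 0 (h′ ⊕ l) ≡ 0ℤ
  S-difference-at-0 = trans (sym (⟦map-Δ⟧-cancel r l T 0 h′)) (ΔT-vanishes-at-0 h′)

record Binomial : Set where
  constructor binomial
  field
    A B : ℤ → ℤ
    C D : ℤ
open Binomial

⟦_⟧₁ : Binomial → ℕ → ℤ → ℤ
⟦ f ⟧₁ x u = A f (u + + x * C f) + B f (u + + x * D f)

∏⟦_⟧ : ∀ {k} → (Fin k → Binomial) → ℕ → Vec ℤ k → ℤ
∏⟦ fs ⟧ x []       = 1ℤ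
∏⟦ fs ⟧ x (h ∷ hs) = ⟦ fs zero ⟧₁ x h * ∏⟦ fs ∘ suc ⟧ x hs

∏-zero : ∀ {k} (fs : Fin k → Binomial) x j → (∀ u → ⟦ fs j ⟧₁ x u ≡ 0ℤ) → ∀ h → ∏⟦ fs ⟧ x h ≡ 0ℤ
∏-zero fs x zero    fs-zero (h ∷ hs) = cong (_* ∏⟦ fs ∘ suc ⟧ x hs) (fs-zero h)
∏-zero fs x (suc j) fs-zero (h ∷ hs) =
  trans (cong (⟦ fs zero ⟧₁ x h *_) (∏-zero (fs ∘ suc) x j fs-zero hs)) (ℤP.*-zeroʳ (⟦ fs zero ⟧₁ x h))

∏-one : ∀ {k} (fs : Fin k → Binomial) → (∀ j → ⟦ fs j ⟧₁ 0 0ℤ ≡ 1ℤ) → ∏⟦ fs ⟧ 0 (replicate k 0ℤ) ≡ 1ℤ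
∏-one {zero}  fs fs-one = refl
∏-one {suc k} fs fs-one = cong₂ _*_ (fs-one zero) (∏-one (fs ∘ suc) (fs-one ∘ suc))

infixr 5 _⊗_

_⊗_ : ∀ {k} → Binomial → List (ShiftTerm k) → List (ShiftTerm (suc k))
f ⊗ []            = []
f ⊗ ((r , l) ∷ T) = ((λ v → A f (head v) * r (tail v)) , C f ∷ l)
                  ∷ ((λ v → B f (head v) * r (tail v)) , D f ∷ l)
                  ∷ f ⊗ T

length-⊗ : ∀ {k} f (T : List (ShiftTerm k)) → length (f ⊗ T) ≡ 2 ℕ.* length T
length-⊗ f []      = refl
length-⊗ f (_ ∷ T) = trans (cong (2 ℕ.+_) (length-⊗ f T)) (sym (ℕP.*-suc 2 (length T)))

⟦⊗⟧ : ∀ {k} f (T : List (ShiftTerm k)) x h hs → ⟦ f ⊗ T ⟧ x (h ∷ hs) ≡ ⟦ f ⟧₁ x h * ⟦ T ⟧ x hs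
⟦⊗⟧ f []            x h hs = sym (ℤP.*-zeroʳ (⟦ f ⟧₁ x h))
⟦⊗⟧ f ((r , l) ∷ T) x h hs =
  trans (cong (λ z → a * ρ + (b * ρ + z)) (⟦⊗⟧ f T x h hs)) (distrib a b ρ (⟦ T ⟧ x hs))
  where
  a = A f (h + + x * C f)
  b = B f (h + + x * D f)
  ρ = r (hs ⊕ x · l)
  distrib : ∀ a b ρ e → a * ρ + (b * ρ + (a + b) * e) ≡ (a + b) * (ρ + e)
  distrib = solve-∀

expand : ∀ {k} → (Fin k → Binomial) → List (ShiftTerm k)
expand {zero}  fs = ((λ _ → 1ℤ) , []) ∷ []
expand {suc k} fs = fs zero ⊗ expand (fs ∘ suc)

length-expand : ∀ {k} (fs : Fin k → Binomial) → length (expand fs) ≡ 2 ^ k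
length-expand {zero}  fs = refl
length-expand {suc k} fs =
  trans (length-⊗ (fs zero) (expand (fs ∘ suc))) (cong (2 ℕ.*_) (length-expand (fs ∘ suc)))

⟦expand⟧ : ∀ {k} (fs : Fin k → Binomial) x h → ⟦ expand fs ⟧ x h ≡ ∏⟦ fs ⟧ x h
⟦expand⟧ {zero}  fs x []       = refl
⟦expand⟧ {suc k} fs x (h ∷ hs) =
  trans (⟦⊗⟧ (fs zero) (expand (fs ∘ suc)) x h hs) (cong (⟦ fs zero ⟧₁ x h *_) (⟦expand⟧ (fs ∘ suc) x hs))

[_∣_] : ℤ → ℤ → ℤ
[ P ∣ u ] = if does (P ∣? u) then 1ℤ else 0ℤ

[∣]-yes : ∀ {P u} → P ∣ u → [ P ∣ u ] ≡ 1ℤ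
[∣]-yes {P} {u} P∣u = cong (λ b → if b then 1ℤ else 0ℤ) (dec-true (P ∣? u) P∣u)

[∣]-no : ∀ {P u} → ¬ P ∣ u → [ P ∣ u ] ≡ 0ℤ
[∣]-no {P} {u} P∤u = cong (λ b → if b then 1ℤ else 0ℤ) (dec-false (P ∣? u) P∤u)

[∣]-periodic : ∀ P u m → [ P ∣ u - m * P ] ≡ [ P ∣ u ]
[∣]-periodic P u m = cong (λ b → if b then 1ℤ else 0ℤ) (does-⇔ (mk⇔ to from) (P ∣? u - m * P) (P ∣? u))
  where
  P∣mP : P ∣ m * P
  P∣mP = ∣n⇒∣m*n m ∣-refl
  to : P ∣ u - m * P → P ∣ u
  to P∣u-mP = subst (P ∣_) (sub-add u (m * P)) (∣m∣n⇒∣m+n P∣u-mP P∣mP)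
    where
    sub-add : ∀ u v → (u - v) + v ≡ u
    sub-add = solve-∀
  from : P ∣ u → P ∣ u - m * P
  from P∣u = ∣m∣n⇒∣m-n P∣u P∣mP

i≤i+m*n : ∀ i m n → i ℤ.≤ i + + m * + n
i≤i+m*n i m n = subst (λ z → i ℤ.≤ i + z) (ℤP.pos-* m n) (ℤP.i≤i+j i (+ (m ℕ.* n)))

term-+ : ∀ s i x → term s (i ℕ.+ x) ≡ term s i + + x * + diff s
term-+ s i x = trans (cong (λ z → start s + z * + diff s) (ℤP.pos-+ i x)) (distrib (start s) (+ i) (+ x) (+ diff s))
  where
  distrib : ∀ a i x d → a + (i + x) * d ≡ (a + i * d) + x * d
  distrib = solve-∀

term-mono-≤ : ∀ s {i j} → i ≤ j → term s i ℤ.≤ term s j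
term-mono-≤ s {i} {j} i≤j = ℤP.+-monoʳ-≤ (start s)
  (subst₂ ℤ._≤_ (ℤP.pos-* i (diff s)) (ℤP.pos-* j (diff s)) (ℤ.+≤+ (ℕP.*-monoˡ-≤ (diff s) i≤j)))

-- The bound n < m must be strict: when diff s = 0 the quotient q below is arbitrary.
∈AP-from-∣ : ∀ {s n m} → start s ℤ.≤ n → + diff s ∣ n - start s → m ∈AP s → n ℤ.< m → n ∈AP s
∈AP-from-∣ {s} {n} b≤n e∣n-b (m′ , m′≤len , refl) n<m with ∣⇒∣ᵤ e∣n-b
... | ℕD.divides q ∣n-b∣≡qe = q , ℕP.≤-trans (ℕP.<⇒≤ q<m′) m′≤len , sym n≡term
  where
  n≡term : n ≡ term s q
  n≡term = begin
    n                             ≡⟨ add-sub n (start s) ⟩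
    start s + (n - start s)       ≡⟨ cong (λ z → start s + z) (sym (ℤP.0≤i⇒+∣i∣≡i (ℤP.i≤j⇒0≤j-i b≤n))) ⟩
    start s + + ℤ.∣ n - start s ∣ ≡⟨ cong (λ z → start s + + z) ∣n-b∣≡qe ⟩
    start s + + (q ℕ.* diff s)    ≡⟨ cong (λ z → start s + z) (ℤP.pos-* q (diff s)) ⟩
    term s q                      ∎
    where
    add-sub : ∀ n b → n ≡ b + (n - b)
    add-sub = solve-∀
  q<m′ : q < m′
  q<m′ = ℕP.≰⇒> λ m′≤q →
    ℤP.<⇒≱ n<m (ℤP.≤-trans (term-mono-≤ s m′≤q) (ℤP.≤-reflexive (sym n≡term)))

-- An AP starting above X cannot contain any s₀(t − x), so the constant factor 1 serves for it.
factor : ℤ → ℕ → AP → Binomial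
factor X d s with start s ℤ.≤? X
... | yes _ = binomial (λ v → [ + diff s ∣ v ]) (λ v → - [ + diff s ∣ v - (X - start s) ]) 0ℤ (+ d)
... | no _  = binomial (λ _ → 1ℤ) (λ _ → 0ℤ) 0ℤ 0ℤ

factor-vanishes : ∀ {X d s n} x → n ∈AP s → X ≡ n + + x * + d → ∀ u → ⟦ factor X d s ⟧₁ x u ≡ 0ℤ
factor-vanishes {d = d} {s} x (m , _ , refl) refl u with start s ℤ.≤? (term s m + + x * + d)
... | no b≰X = ⊥-elim (b≰X (ℤP.≤-trans (i≤i+m*n (start s) m (diff s)) (i≤i+m*n (term s m) x d)))
... | yes _ = begin
  [ e ∣ u + + x * 0ℤ ] + - [ e ∣ (u + + x * + d) - (X - start s) ]
    ≡⟨ cong₂ (λ v w → [ e ∣ v ] + - [ e ∣ w ]) u+x*0≡u (shift u (+ x * + d) (start s) (+ m * e)) ⟩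
  [ e ∣ u ] + - [ e ∣ u - + m * e ]
    ≡⟨ cong (λ z → [ e ∣ u ] + - z) ([∣]-periodic e u (+ m)) ⟩
  [ e ∣ u ] + - [ e ∣ u ]
    ≡⟨ ℤP.+-inverseʳ [ e ∣ u ] ⟩
  0ℤ ∎
  where
  e = + diff s
  X = term s m + + x * + d
  u+x*0≡u : u + + x * 0ℤ ≡ u
  u+x*0≡u = trans (cong (λ z → u + z) (ℤP.*-zeroʳ (+ x))) (ℤP.+-identityʳ u)
  shift : ∀ u xd b me → (u + xd) - (((b + me) + xd) - b) ≡ u - me
  shift = solve-∀

factor-at-origin : ∀ {X d s} → ¬ X ∈AP s → Σ ℤ (λ m → m ∈AP s × X ℤ.< m) → ⟦ factor X d s ⟧₁ 0 0ℤ ≡ 1ℤ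
factor-at-origin {X} {d} {s} X∉s (m , m∈s , X<m) with start s ℤ.≤? X
... | no _    = refl
... | yes b≤X = cong₂ (λ a b → a + - b) ([∣]-yes {e} {0ℤ} (divides 0ℤ refl)) ([∣]-no e∤-[X-b])
  where
  e = + diff s
  e∤-[X-b] : ¬ e ∣ 0ℤ - (X - start s)
  e∤-[X-b] e∣ = X∉s (∈AP-from-∣ b≤X (subst (e ∣_) (neg-neg (X - start s)) (∣m⇒∣-m e∣)) m∈s X<m)
    where
    neg-neg : ∀ z → - (0ℤ - z) ≡ z
    neg-neg = solve-∀

lemma1 : (k t : ℕ) → 1 ≤ k → (s₀ : AP) → (s : Fin k → AP)
    → t ≤ len s₀
    → (∀ (i : ℕ) → i < t → Σ (Fin k) λ j → term s₀ i ∈AP s j)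
    → (∀ (j : Fin k) → ¬ (term s₀ t ∈AP s j))
    → (∀ (j : Fin k) → Σ ℤ λ m → (m ∈AP s j) × (term s₀ t ℤ.< m))
    → t < 2 ^ k
lemma1 k t _ s₀ s _ covered X∉s above = ℕP.≰⇒> λ 2^k≤t → 1≢0 (begin
  1ℤ                   ≡⟨ sym (∏-one fs (λ j → factor-at-origin {X} {diff s₀} {s j} (X∉s j) (above j))) ⟩
  ∏⟦ fs ⟧ 0 origin     ≡⟨ sym (⟦expand⟧ fs 0 origin) ⟩
  ⟦ expand fs ⟧ 0 origin
    ≡⟨ vanishes-at-0 t (expand fs) (subst (_≤ t) (sym (length-expand fs)) 2^k≤t) expand-vanishes origin ⟩
  0ℤ                   ∎)
  where
  X = term s₀ t
  fs : Fin k → Binomial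
  fs j = factor X (diff s₀) (s j)
  origin = replicate k 0ℤ
  1≢0 : ¬ 1ℤ ≡ 0ℤ
  1≢0 ()
  expand-vanishes : ∀ x → 1 ≤ x → x ≤ t → ∀ h → ⟦ expand fs ⟧ x h ≡ 0ℤ
  expand-vanishes x 1≤x x≤t h with covered (t ∸ x) (ℕP.∸-monoʳ-< {t} {x} {0} 1≤x x≤t)
  ... | j , t∸x∈s = trans (⟦expand⟧ fs x h)
    (∏-zero fs x j (factor-vanishes {X} {diff s₀} {s j} x t∸x∈s X-split) h)
    where
    X-split : X ≡ term s₀ (t ∸ x) + + x * + diff s₀
    X-split = trans (cong (term s₀) (sym (ℕP.m∸n+n≡m x≤t))) (term-+ s₀ (t ∸ x) x)
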